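{- (i) Let $(\mathcal{A}, \to_{\mathcal{A}})$ be a strong algebra, $\mathcal{B}$ a bounded distributive lattice and $f: \mathcal{A} \to \mathcal{B}$ a bounded lattice map which has a monotone left inverse, i.e., an order-preserving $g: \mathcal{B} \to \mathcal{A}$ with $g f = \mathrm{id}_{\mathcal{A}}$. Then there is an implication $\to_{\mathcal{B}}$ over $\mathcal{B}$ such that $f(a \to_{\mathcal{A}} b) = f(a) \to_{\mathcal{B}} f(b)$ for all $a, b \in \mathcal{A}$. (ii) Let $(\mathcal{A}, \to_{\mathcal{A}})$ be a strong algebra with $\to_{\mathcal{A}}$ weakly Boolean, $\mathcal{B}$ a bounded distributive lattice and $f: \mathcal{A} \to \mathcal{B}$ a surjective bounded lattice homomorphism. Then there is a unique weakly Boolean implication $\to_{\mathcal{B}}$ over $\mathcal{B}$ such that $f(a \to_{\mathcal{A}} b) = f(a) \to_{\mathcal{B}} f(b)$ for all $a, b \in \mathcal{A}$. If $\mathcal{B}$ is a Boolean algebra, the same conclusion holds for any (not necessarily surjective) bounded lattice homomorphism $f: \mathcal{A} \to \mathcal{B}$.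
   Context: For a bounded distributive lattice $\mathcal{A}$, an implication over $\mathcal{A}$ is a binary operation $\to$ on $\mathcal{A}$ which is order-reversing in its first argument and order-preserving in its second argument and satisfies $a \to a = 1$ and $(a \to b) \wedge (b \to c) \leq a \to c$ for all $a,b,c$. A strong algebra is a pair $(\mathcal{A},\to)$ of a bounded distributive lattice and an implication over it. An implication is open if $a \wedge b \leq c$ implies $a \leq b \to c$; closed if $a \leq b \vee c$ implies $(a \to b) \vee c = 1$; weakly Boolean if both open and closed. -}

module Defs where

open import Level using (Level; _⊔_; suc)
open import Data.Product using (_×_; Σ; ∃; _,_)
open import Relation.Binary.Core using (Rel)
open import Algebra.Core using (Op₂)
open import Algebra.Definitions using (Identity)
open import Algebra.Lattice.Bundles using (DistributiveLattice; BooleanAlgebra)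
open import Function.Definitions using (Surjective)

record BoundedDistributiveLattice c ℓ : Set (suc (c ⊔ ℓ)) where
  field
    distributiveLattice : DistributiveLattice c ℓ
  open DistributiveLattice distributiveLattice public
  field
    ⊤ : Carrier
    ⊥ : Carrier
    ∧-identity : Identity _≈_ ⊤ _∧_
    ∨-identity : Identity _≈_ ⊥ _∨_

  infix 4 _≤_
  _≤_ : Rel Carrier ℓ
  a ≤ b = (a ∧ b) ≈ a

module _ {c ℓ} (L : BoundedDistributiveLattice c ℓ) where
  open BoundedDistributiveLattice L

  record IsImplication (_⇒_ : Op₂ Carrier) : Set (c ⊔ ℓ) where
    field
      antitoneˡ : ∀ {a a′ b} → a ≤ a′ → (a′ ⇒ b) ≤ (a ⇒ b)
      monotoneʳ : ∀ {a b b′} → b ≤ b′ → (a ⇒ b) ≤ (a ⇒ b′)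
      refl-⊤    : ∀ a → (a ⇒ a) ≈ ⊤
      trans-≤   : ∀ a b c → ((a ⇒ b) ∧ (b ⇒ c)) ≤ (a ⇒ c)

  IsOpen : Op₂ Carrier → Set (c ⊔ ℓ)
  IsOpen _⇒_ = ∀ a b c → (a ∧ b) ≤ c → a ≤ (b ⇒ c)

  IsClosed : Op₂ Carrier → Set (c ⊔ ℓ)
  IsClosed _⇒_ = ∀ a b c → a ≤ (b ∨ c) → ((a ⇒ b) ∨ c) ≈ ⊤

  IsWeaklyBoolean : Op₂ Carrier → Set (c ⊔ ℓ)
  IsWeaklyBoolean _⇒_ = IsOpen _⇒_ × IsClosed _⇒_

record StrongAlgebra c ℓ : Set (suc (c ⊔ ℓ)) where
  field
    bdl           : BoundedDistributiveLattice c ℓ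
  open BoundedDistributiveLattice bdl public
  field
    _⇒_           : Op₂ Carrier
    isImplication : IsImplication bdl _⇒_

module _ {c₁ ℓ₁ c₂ ℓ₂}
         (A : BoundedDistributiveLattice c₁ ℓ₁)
         (B : BoundedDistributiveLattice c₂ ℓ₂) where
  private
    module A = BoundedDistributiveLattice A
    module B = BoundedDistributiveLattice B

  record IsBoundedLatticeHom (f : A.Carrier → B.Carrier) : Set (c₁ ⊔ ℓ₁ ⊔ ℓ₂) where
    field
      cong   : ∀ {x y} → x A.≈ y → f x B.≈ f y
      ∧-homo : ∀ x y → f (x A.∧ y) B.≈ (f x B.∧ f y)
      ∨-homo : ∀ x y → f (x A.∨ y) B.≈ (f x B.∨ f y)
      ⊤-homo : f A.⊤ B.≈ B.⊤
      ⊥-homo : f A.⊥ B.≈ B.⊥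

  IsMonotone : (B.Carrier → A.Carrier) → Set (c₂ ⊔ ℓ₁ ⊔ ℓ₂)
  IsMonotone g = (∀ {x y} → x B.≈ y → g x A.≈ g y) × (∀ {x y} → x B.≤ y → g x A.≤ g y)

-- A bounded distributive lattice is a Boolean algebra iff every element
-- has a complement (complements are then unique; ¬ is determined).
module _ {c ℓ} (B : BoundedDistributiveLattice c ℓ) where
  open BoundedDistributiveLattice B
  IsBooleanLattice : Set (c ⊔ ℓ)
  IsBooleanLattice = ∀ x → ∃ λ y → ((x ∨ y) ≈ ⊤) × ((x ∧ y) ≈ ⊥)

{-# OPTIONS --safe #-}
module Submission where

open import Defs
open import Level using (Level; _⊔_)
open import Data.Product using (_×_; Σ; ∃; _,_; proj₁; proj₂)
open import Algebra.Core using (Op₂)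
open import Function.Definitions using (Surjective)
import Algebra.Lattice.Properties.Lattice as AlgebraicLatticeProperties
import Relation.Binary.Lattice as OrderTheoretic
import Relation.Binary.Lattice.Properties.JoinSemilattice as JoinSemilatticeProperties
import Relation.Binary.Lattice.Properties.MeetSemilattice as MeetSemilatticeProperties
import Relation.Binary.Reasoning.PartialOrder as PosetReasoning

-- A weakly Boolean implication is determined by κ = ⊤ → ⊥: openness and closedness make
-- a → ⊥ a relative complement of a over κ, which is unique, and then a → b = (a → ⊥) ∨ b.
-- Conversely, if every element x has a relative complement ¬κ x over some κ, then
-- x → y = ¬κ x ∨ y is a weakly Boolean implication.  Bounded lattice maps preserve relative
-- complements, so B has them over κ = f (⊤ → ⊥) whenever f is surjective, and over any κ
-- when B is Boolean (take κ ∨ y for a complement y of x); uniqueness of relative complements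
-- then makes f preserve → and forces uniqueness of the implication.  For (i) one simply
-- takes x → y = f (g x → g y).

module LatticeOrder {c ℓ} (L : BoundedDistributiveLattice c ℓ) where
  open BoundedDistributiveLattice L

  private
    module Natural =
      OrderTheoretic.Lattice (AlgebraicLatticeProperties.∨-∧-orderTheoreticLattice lattice)

  -- The order a ∧ b ≈ a of BoundedDistributiveLattice is the library's natural order a ≈ a ∧ b read backwards.
  orderTheoreticLattice : OrderTheoretic.Lattice c ℓ ℓ
  orderTheoreticLattice = record
    { _≤_       = _≤_
    ; isLattice = record
      { isPartialOrder = record
        { isPreorder = record
          { isEquivalence = isEquivalence
          ; reflexive     = λ x≈y → sym (Natural.reflexive x≈y)
          ; trans         = λ x≤y y≤z → sym (Natural.trans (sym x≤y) (sym y≤z))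
          }
        ; antisym = λ x≤y y≤x → Natural.antisym (sym x≤y) (sym y≤x)
        }
      ; supremum = λ x y → sym (Natural.x≤x∨y x y) , sym (Natural.y≤x∨y x y)
                         , λ z x≤z y≤z → sym (Natural.∨-least (sym x≤z) (sym y≤z))
      ; infimum  = λ x y → sym (Natural.x∧y≤x x y) , sym (Natural.x∧y≤y x y)
                         , λ z z≤x z≤y → sym (Natural.∧-greatest (sym z≤x) (sym z≤y))
      }
    }

  open OrderTheoretic.Lattice orderTheoreticLattice public
    using (poset; x≤x∨y; y≤x∨y; ∨-least; x∧y≤x; x∧y≤y; ∧-greatest)
    renaming (refl to ≤-refl; reflexive to ≤-reflexive; trans to ≤-trans; antisym to ≤-antisym)
  open JoinSemilatticeProperties (OrderTheoretic.Lattice.joinSemilattice orderTheoreticLattice)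
    public using (∨-monotonic)
  open MeetSemilatticeProperties (OrderTheoretic.Lattice.meetSemilattice orderTheoreticLattice)
    public using (∧-monotonic)
  open PosetReasoning poset

  x≤⊤ : ∀ {x} → x ≤ ⊤
  x≤⊤ {x} = proj₂ ∧-identity x

  ⊥≤x : ∀ {x} → ⊥ ≤ x
  ⊥≤x {x} = ≤-trans (y≤x∨y x ⊥) (≤-reflexive (proj₂ ∨-identity x))

  ⊤≤x⇒x≈⊤ : ∀ {x} → ⊤ ≤ x → x ≈ ⊤
  ⊤≤x⇒x≈⊤ = ≤-antisym x≤⊤

  ∨≈⊤⇒∧-split : ∀ {x y z} → y ∨ z ≈ ⊤ → x ≈ (x ∧ y) ∨ (x ∧ z)
  ∨≈⊤⇒∧-split {x} {y} {z} y∨z≈⊤ = begin-equality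
    x                  ≈⟨ proj₂ ∧-identity x ⟨
    x ∧ ⊤              ≈⟨ ∧-congˡ y∨z≈⊤ ⟨
    x ∧ (y ∨ z)        ≈⟨ ∧-distribˡ-∨ x y z ⟩
    (x ∧ y) ∨ (x ∧ z)  ∎

  -- m is a complement of x ∨ κ in the interval [κ, ⊤].
  record IsRelativeComplement (κ x m : Carrier) : Set ℓ where
    field
      x∨m≈⊤ : x ∨ m ≈ ⊤
      x∧m≤κ : x ∧ m ≤ κ
      κ≤m   : κ ≤ m

  open IsRelativeComplement public

  HasRelativeComplements : Carrier → Set (c ⊔ ℓ)
  HasRelativeComplements κ = ∀ x → ∃ (IsRelativeComplement κ x)

  isRelativeComplement-resp : ∀ {κ κ′ x x′ m m′} → κ ≈ κ′ → x ≈ x′ → m ≈ m′ →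
                              IsRelativeComplement κ x m → IsRelativeComplement κ′ x′ m′
  isRelativeComplement-resp κ≈κ′ x≈x′ m≈m′ rc = record
    { x∨m≈⊤ = trans (∨-cong (sym x≈x′) (sym m≈m′)) (x∨m≈⊤ rc)
    ; x∧m≤κ = begin
        _  ≈⟨ ∧-cong x≈x′ m≈m′ ⟨
        _  ≤⟨ x∧m≤κ rc ⟩
        _  ≈⟨ κ≈κ′ ⟩
        _  ∎
    ; κ≤m   = begin
        _  ≈⟨ κ≈κ′ ⟨
        _  ≤⟨ κ≤m rc ⟩
        _  ≈⟨ m≈m′ ⟩
        _  ∎
    }

  relativeComplement-antitone : ∀ {κ x x′ m m′} → x ≤ x′ →
    IsRelativeComplement κ x m → IsRelativeComplement κ x′ m′ → m′ ≤ m
  relativeComplement-antitone {κ} {x} {x′} {m} {m′} x≤x′ rc rc′ = begin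
    m′                   ≈⟨ ∨≈⊤⇒∧-split (x∨m≈⊤ rc) ⟩
    (m′ ∧ x) ∨ (m′ ∧ m)  ≤⟨ ∨-monotonic m′∧x≤x′∧m′ (x∧y≤y m′ m) ⟩
    (x′ ∧ m′) ∨ m        ≤⟨ ∨-monotonic (x∧m≤κ rc′) ≤-refl ⟩
    κ ∨ m                ≤⟨ ∨-least (κ≤m rc) ≤-refl ⟩
    m                    ∎
    where
    m′∧x≤x′∧m′ : m′ ∧ x ≤ x′ ∧ m′
    m′∧x≤x′∧m′ = ∧-greatest (≤-trans (x∧y≤y m′ x) x≤x′) (x∧y≤x m′ x)

  relativeComplement-unique : ∀ {κ x m m′} →
    IsRelativeComplement κ x m → IsRelativeComplement κ x m′ → m ≈ m′
  relativeComplement-unique rc rc′ =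
    ≤-antisym (relativeComplement-antitone ≤-refl rc′ rc) (relativeComplement-antitone ≤-refl rc rc′)

  complement⇒isRelativeComplement : ∀ κ {x y} → x ∨ y ≈ ⊤ → x ∧ y ≈ ⊥ →
                                    IsRelativeComplement κ x (κ ∨ y)
  complement⇒isRelativeComplement κ {x} {y} x∨y≈⊤ x∧y≈⊥ = record
    { x∨m≈⊤ = ⊤≤x⇒x≈⊤ (begin
        ⊤            ≈⟨ x∨y≈⊤ ⟨
        x ∨ y        ≤⟨ ∨-monotonic ≤-refl (y≤x∨y κ y) ⟩
        x ∨ (κ ∨ y)  ∎)
    ; x∧m≤κ = begin
        x ∧ (κ ∨ y)        ≈⟨ ∧-distribˡ-∨ x κ y ⟩
        (x ∧ κ) ∨ (x ∧ y)  ≈⟨ ∨-congˡ x∧y≈⊥ ⟩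
        (x ∧ κ) ∨ ⊥        ≤⟨ ∨-least (x∧y≤y x κ) ⊥≤x ⟩
        κ                  ∎
    ; κ≤m   = x≤x∨y κ y
    }

  isBooleanLattice⇒hasRelativeComplements : IsBooleanLattice L → ∀ κ → HasRelativeComplements κ
  isBooleanLattice⇒hasRelativeComplements isBoolean κ x =
    let y , x∨y≈⊤ , x∧y≈⊥ = isBoolean x
    in κ ∨ y , complement⇒isRelativeComplement κ x∨y≈⊤ x∧y≈⊥

module ImplicationProperties {c ℓ} (L : BoundedDistributiveLattice c ℓ)
  {_⇒_ : Op₂ (BoundedDistributiveLattice.Carrier L)} (isImplication : IsImplication L _⇒_) where
  open BoundedDistributiveLattice L
  open LatticeOrder L
  open IsImplication isImplication
  open PosetReasoning poset

  ⇒-cong : ∀ {a a′ b b′} → a ≈ a′ → b ≈ b′ → a ⇒ b ≈ a′ ⇒ b′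
  ⇒-cong a≈a′ b≈b′ = ≤-antisym
    (≤-trans (antitoneˡ (≤-reflexive (sym a≈a′))) (monotoneʳ (≤-reflexive b≈b′)))
    (≤-trans (antitoneˡ (≤-reflexive a≈a′)) (monotoneʳ (≤-reflexive (sym b≈b′))))

  module _ (isWeaklyBoolean : IsWeaklyBoolean L _⇒_) where
    private
      isOpen : IsOpen L _⇒_
      isOpen = proj₁ isWeaklyBoolean

      isClosed : IsClosed L _⇒_
      isClosed = proj₂ isWeaklyBoolean

    ⇒⊥-isRelativeComplement : ∀ a → IsRelativeComplement (⊤ ⇒ ⊥) a (a ⇒ ⊥)
    ⇒⊥-isRelativeComplement a = record
      { x∨m≈⊤ = trans (∨-comm a (a ⇒ ⊥)) (isClosed a ⊥ a (y≤x∨y ⊥ a))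
      ; x∧m≤κ = begin
          a ∧ (a ⇒ ⊥)        ≤⟨ ∧-monotonic (isOpen a ⊤ a (x∧y≤x a ⊤)) ≤-refl ⟩
          (⊤ ⇒ a) ∧ (a ⇒ ⊥)  ≤⟨ trans-≤ ⊤ a ⊥ ⟩
          ⊤ ⇒ ⊥              ∎
      ; κ≤m   = antitoneˡ x≤⊤
      }

    ⇒≈⇒⊥∨ : ∀ a b → a ⇒ b ≈ (a ⇒ ⊥) ∨ b
    ⇒≈⇒⊥∨ a b = ≤-antisym
      (begin
        a ⇒ b                                ≈⟨ ∨≈⊤⇒∧-split (x∨m≈⊤ (⇒⊥-isRelativeComplement b)) ⟩
        ((a ⇒ b) ∧ b) ∨ ((a ⇒ b) ∧ (b ⇒ ⊥))  ≤⟨ ∨-monotonic (x∧y≤y (a ⇒ b) b) (trans-≤ a b ⊥) ⟩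
        b ∨ (a ⇒ ⊥)                          ≈⟨ ∨-comm b (a ⇒ ⊥) ⟩
        (a ⇒ ⊥) ∨ b                          ∎)
      (∨-least (monotoneʳ ⊥≤x) (isOpen b a b (x∧y≤x b a)))

module RelativeComplementImplication {c ℓ} (L : BoundedDistributiveLattice c ℓ)
  {κ : BoundedDistributiveLattice.Carrier L}
  (hasRelativeComplements : LatticeOrder.HasRelativeComplements L κ) where
  open BoundedDistributiveLattice L
  open LatticeOrder L
  open PosetReasoning poset

  ¬κ : Carrier → Carrier
  ¬κ x = proj₁ (hasRelativeComplements x)

  ¬κ-isRelativeComplement : ∀ x → IsRelativeComplement κ x (¬κ x)
  ¬κ-isRelativeComplement x = proj₂ (hasRelativeComplements x)

  _⇒_ : Op₂ Carrier
  x ⇒ y = ¬κ x ∨ y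

  isImplication : IsImplication L _⇒_
  isImplication = record
    { antitoneˡ = λ a≤a′ → ∨-monotonic (¬κ-antitone a≤a′) ≤-refl
    ; monotoneʳ = λ b≤b′ → ∨-monotonic ≤-refl b≤b′
    ; refl-⊤    = λ a → trans (∨-comm (¬κ a) a) (x∨m≈⊤ (¬κ-isRelativeComplement a))
    ; trans-≤   = ⇒-trans
    }
    where
    ¬κ-antitone : ∀ {a a′} → a ≤ a′ → ¬κ a′ ≤ ¬κ a
    ¬κ-antitone a≤a′ = relativeComplement-antitone a≤a′
      (¬κ-isRelativeComplement _) (¬κ-isRelativeComplement _)

    ⇒-trans : ∀ a b c → (a ⇒ b) ∧ (b ⇒ c) ≤ a ⇒ c
    ⇒-trans a b c = begin
      (¬κ a ∨ b) ∧ (b ⇒ c)                         ≈⟨ ∧-distribʳ-∨ (b ⇒ c) (¬κ a) b ⟩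
      (¬κ a ∧ (b ⇒ c)) ∨ (b ∧ (¬κ b ∨ c))          ≈⟨ ∨-congˡ (∧-distribˡ-∨ b (¬κ b) c) ⟩
      (¬κ a ∧ (b ⇒ c)) ∨ ((b ∧ ¬κ b) ∨ (b ∧ c))    ≤⟨ ∨-monotonic (x∧y≤x (¬κ a) (b ⇒ c)) b∧¬κb∨b∧c≤a⇒c ⟩
      ¬κ a ∨ (a ⇒ c)                               ≤⟨ ∨-least (x≤x∨y (¬κ a) c) ≤-refl ⟩
      a ⇒ c                                        ∎
      where
      b∧¬κb∨b∧c≤a⇒c : (b ∧ ¬κ b) ∨ (b ∧ c) ≤ a ⇒ c
      b∧¬κb∨b∧c≤a⇒c = ∨-monotonic
        (≤-trans (x∧m≤κ (¬κ-isRelativeComplement b)) (κ≤m (¬κ-isRelativeComplement a)))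
        (x∧y≤y b c)

  isWeaklyBoolean : IsWeaklyBoolean L _⇒_
  isWeaklyBoolean = isOpen , isClosed
    where
    isOpen : IsOpen L _⇒_
    isOpen a b c a∧b≤c = begin
      a                        ≈⟨ ∨≈⊤⇒∧-split (x∨m≈⊤ (¬κ-isRelativeComplement b)) ⟩
      (a ∧ b) ∨ (a ∧ ¬κ b)     ≤⟨ ∨-least (≤-trans a∧b≤c (y≤x∨y (¬κ b) c))
                                          (≤-trans (x∧y≤y a (¬κ b)) (x≤x∨y (¬κ b) c)) ⟩
      b ⇒ c                    ∎

    isClosed : IsClosed L _⇒_
    isClosed a b c a≤b∨c = ⊤≤x⇒x≈⊤ (begin
      ⊤                 ≈⟨ x∨m≈⊤ (¬κ-isRelativeComplement a) ⟨
      a ∨ ¬κ a          ≤⟨ ∨-least (≤-trans a≤b∨c (∨-monotonic (y≤x∨y (¬κ a) b) ≤-refl))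
                                   (≤-trans (x≤x∨y (¬κ a) b) (x≤x∨y (¬κ a ∨ b) c)) ⟩
      (a ⇒ b) ∨ c       ∎)

  ⇒-unique : ∀ {_⇒′_} → IsImplication L _⇒′_ → IsWeaklyBoolean L _⇒′_ → ⊤ ⇒′ ⊥ ≈ κ →
             ∀ x y → x ⇒′ y ≈ x ⇒ y
  ⇒-unique {_⇒′_} isImplication′ isWeaklyBoolean′ ⊤⇒′⊥≈κ x y = begin-equality
    x ⇒′ y          ≈⟨ ⇒≈⇒⊥∨ isWeaklyBoolean′ x y ⟩
    (x ⇒′ ⊥) ∨ y    ≈⟨ ∨-congʳ x⇒′⊥≈¬κx ⟩
    x ⇒ y           ∎
    where
    open ImplicationProperties L isImplication′ using (⇒⊥-isRelativeComplement; ⇒≈⇒⊥∨)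

    x⇒′⊥≈¬κx : x ⇒′ ⊥ ≈ ¬κ x
    x⇒′⊥≈¬κx = relativeComplement-unique
      (isRelativeComplement-resp ⊤⇒′⊥≈κ refl refl (⇒⊥-isRelativeComplement isWeaklyBoolean′ x))
      (¬κ-isRelativeComplement x)

module BoundedLatticeHomProperties {c₁ ℓ₁ c₂ ℓ₂}
  {A : BoundedDistributiveLattice c₁ ℓ₁} {B : BoundedDistributiveLattice c₂ ℓ₂}
  {f : BoundedDistributiveLattice.Carrier A → BoundedDistributiveLattice.Carrier B}
  (isHom : IsBoundedLatticeHom A B f) where
  private
    module A = BoundedDistributiveLattice A
    module B = BoundedDistributiveLattice B
    module OA = LatticeOrder A
    module OB = LatticeOrder B
  open IsBoundedLatticeHom isHom

  f-monotone : ∀ {x y} → x A.≤ y → f x B.≤ f y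
  f-monotone {x} {y} x≤y = B.trans (B.sym (∧-homo x y)) (cong x≤y)

  f-isRelativeComplement : ∀ {κ x m} → OA.IsRelativeComplement κ x m →
                           OB.IsRelativeComplement (f κ) (f x) (f m)
  f-isRelativeComplement {κ} {x} {m} rc = record
    { x∨m≈⊤ = B.trans (B.sym (∨-homo x m)) (B.trans (cong (OA.x∨m≈⊤ rc)) ⊤-homo)
    ; x∧m≤κ = OB.≤-trans (OB.≤-reflexive (B.sym (∧-homo x m))) (f-monotone (OA.x∧m≤κ rc))
    ; κ≤m   = f-monotone (OA.κ≤m rc)
    }

module RetractImplication {c₁ ℓ₁ c₂ ℓ₂} (𝒜 : StrongAlgebra c₁ ℓ₁)
  {B : BoundedDistributiveLattice c₂ ℓ₂}
  {f : StrongAlgebra.Carrier 𝒜 → BoundedDistributiveLattice.Carrier B}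
  (isHom : IsBoundedLatticeHom (StrongAlgebra.bdl 𝒜) B f)
  {g : BoundedDistributiveLattice.Carrier B → StrongAlgebra.Carrier 𝒜}
  (g-isMonotone : IsMonotone (StrongAlgebra.bdl 𝒜) B g)
  (gf≈id : ∀ a → StrongAlgebra._≈_ 𝒜 (g (f a)) a) where
  private
    module A = StrongAlgebra 𝒜
    module B = BoundedDistributiveLattice B
    module OB = LatticeOrder B
  open IsBoundedLatticeHom isHom
  open BoundedLatticeHomProperties isHom
  open IsImplication A.isImplication
  open ImplicationProperties A.bdl A.isImplication using (⇒-cong)

  _⇒_ : Op₂ B.Carrier
  x ⇒ y = f (g x A.⇒ g y)

  isImplication : IsImplication B _⇒_
  isImplication = record
    { antitoneˡ = λ a≤a′ → f-monotone (antitoneˡ (proj₂ g-isMonotone a≤a′))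
    ; monotoneʳ = λ b≤b′ → f-monotone (monotoneʳ (proj₂ g-isMonotone b≤b′))
    ; refl-⊤    = λ a → B.trans (cong (refl-⊤ (g a))) ⊤-homo
    ; trans-≤   = λ a b c → OB.≤-trans (OB.≤-reflexive (B.sym (∧-homo _ _)))
                                       (f-monotone (trans-≤ (g a) (g b) (g c)))
    }

  preserves⇒ : ∀ a b → f (a A.⇒ b) B.≈ f a ⇒ f b
  preserves⇒ a b = cong (⇒-cong (A.sym (gf≈id a)) (A.sym (gf≈id b)))

module WeaklyBooleanTransport {c₁ ℓ₁ c₂ ℓ₂} (𝒜 : StrongAlgebra c₁ ℓ₁)
  (𝒜-isWeaklyBoolean : IsWeaklyBoolean (StrongAlgebra.bdl 𝒜) (StrongAlgebra._⇒_ 𝒜))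
  {B : BoundedDistributiveLattice c₂ ℓ₂}
  {f : StrongAlgebra.Carrier 𝒜 → BoundedDistributiveLattice.Carrier B}
  (isHom : IsBoundedLatticeHom (StrongAlgebra.bdl 𝒜) B f) where
  private
    module A = StrongAlgebra 𝒜
    module B = BoundedDistributiveLattice B
    module OB = LatticeOrder B
  open IsBoundedLatticeHom isHom
  open BoundedLatticeHomProperties isHom
  open ImplicationProperties A.bdl A.isImplication using (⇒⊥-isRelativeComplement; ⇒≈⇒⊥∨)
  open PosetReasoning OB.poset

  κ : B.Carrier
  κ = f (A.⊤ A.⇒ A.⊥)

  f-⇒⊥-isRelativeComplement : ∀ a → OB.IsRelativeComplement κ (f a) (f (a A.⇒ A.⊥))
  f-⇒⊥-isRelativeComplement a =
    f-isRelativeComplement (⇒⊥-isRelativeComplement 𝒜-isWeaklyBoolean a)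

  surjective⇒hasRelativeComplements : Surjective A._≈_ B._≈_ f → OB.HasRelativeComplements κ
  surjective⇒hasRelativeComplements surjective y =
    let a , fa≈y = surjective y
    in f (a A.⇒ A.⊥) ,
       OB.isRelativeComplement-resp B.refl (fa≈y A.refl) B.refl (f-⇒⊥-isRelativeComplement a)

  Preserves⇒ : Op₂ B.Carrier → Set (c₁ ⊔ ℓ₂)
  Preserves⇒ _⇒′_ = ∀ a b → f (a A.⇒ b) B.≈ f a ⇒′ f b

  module _ (hasRelativeComplements : OB.HasRelativeComplements κ) where
    open RelativeComplementImplication B hasRelativeComplements

    preserves⇒ : Preserves⇒ _⇒_
    preserves⇒ a b = begin-equality
      f (a A.⇒ b)                 ≈⟨ cong (⇒≈⇒⊥∨ 𝒜-isWeaklyBoolean a b) ⟩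
      f ((a A.⇒ A.⊥) A.∨ b)       ≈⟨ ∨-homo (a A.⇒ A.⊥) b ⟩
      f (a A.⇒ A.⊥) B.∨ f b       ≈⟨ B.∨-congʳ f[a⇒⊥]≈¬κfa ⟩
      f a ⇒ f b                   ∎
      where
      f[a⇒⊥]≈¬κfa : f (a A.⇒ A.⊥) B.≈ ¬κ (f a)
      f[a⇒⊥]≈¬κfa = OB.relativeComplement-unique
        (f-⇒⊥-isRelativeComplement a) (¬κ-isRelativeComplement (f a))

    unique-preserves⇒ : ∀ {_⇒′_} → IsImplication B _⇒′_ → IsWeaklyBoolean B _⇒′_ →
                        Preserves⇒ _⇒′_ → ∀ x y → x ⇒′ y B.≈ x ⇒ y
    unique-preserves⇒ {_⇒′_} isImplication′ isWeaklyBoolean′ preserves⇒′ =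
      ⇒-unique isImplication′ isWeaklyBoolean′ (begin-equality
        B.⊤ ⇒′ B.⊥       ≈⟨ ⇒′-cong ⊤-homo ⊥-homo ⟨
        f A.⊤ ⇒′ f A.⊥   ≈⟨ preserves⇒′ A.⊤ A.⊥ ⟨
        κ                ∎)
      where open ImplicationProperties B isImplication′ using () renaming (⇒-cong to ⇒′-cong)

    uniqueWeaklyBooleanImplication :
      Σ (Op₂ B.Carrier) λ _⇒B_ →
        (IsImplication B _⇒B_ × IsWeaklyBoolean B _⇒B_ × Preserves⇒ _⇒B_)
        × (∀ (_⇒′_ : Op₂ B.Carrier) → IsImplication B _⇒′_ → IsWeaklyBoolean B _⇒′_ →
           Preserves⇒ _⇒′_ → ∀ x y → x ⇒′ y B.≈ x ⇒B y)
    uniqueWeaklyBooleanImplication =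
      _⇒_ , (isImplication , isWeaklyBoolean , preserves⇒) , λ _ → unique-preserves⇒

lemma4p1 : ∀ {c₁ ℓ₁ c₂ ℓ₂ : Level}
  -- (i)
  → ((𝒜 : StrongAlgebra c₁ ℓ₁) (B : BoundedDistributiveLattice c₂ ℓ₂)
     (f : StrongAlgebra.Carrier 𝒜 → BoundedDistributiveLattice.Carrier B)
     → IsBoundedLatticeHom (StrongAlgebra.bdl 𝒜) B f
     → (g : BoundedDistributiveLattice.Carrier B → StrongAlgebra.Carrier 𝒜)
     → IsMonotone (StrongAlgebra.bdl 𝒜) B g
     → (∀ a → StrongAlgebra._≈_ 𝒜 (g (f a)) a)
     → Σ (Op₂ (BoundedDistributiveLattice.Carrier B)) λ _⇒B_ →
         IsImplication B _⇒B_
         × (∀ a b → BoundedDistributiveLattice._≈_ B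
                      (f (StrongAlgebra._⇒_ 𝒜 a b)) (f a ⇒B f b)))
  -- (ii), surjective case
  × ((𝒜 : StrongAlgebra c₁ ℓ₁) (B : BoundedDistributiveLattice c₂ ℓ₂)
     → IsWeaklyBoolean (StrongAlgebra.bdl 𝒜) (StrongAlgebra._⇒_ 𝒜)
     → (f : StrongAlgebra.Carrier 𝒜 → BoundedDistributiveLattice.Carrier B)
     → IsBoundedLatticeHom (StrongAlgebra.bdl 𝒜) B f
     → Surjective (StrongAlgebra._≈_ 𝒜) (BoundedDistributiveLattice._≈_ B) f
     → Σ (Op₂ (BoundedDistributiveLattice.Carrier B)) λ _⇒B_ →
         (IsImplication B _⇒B_
          × IsWeaklyBoolean B _⇒B_
          × (∀ a b → BoundedDistributiveLattice._≈_ B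
                       (f (StrongAlgebra._⇒_ 𝒜 a b)) (f a ⇒B f b)))
         × (∀ (_⇒′_ : Op₂ (BoundedDistributiveLattice.Carrier B))
            → IsImplication B _⇒′_
            → IsWeaklyBoolean B _⇒′_
            → (∀ a b → BoundedDistributiveLattice._≈_ B
                         (f (StrongAlgebra._⇒_ 𝒜 a b)) (f a ⇒′ f b))
            → ∀ x y → BoundedDistributiveLattice._≈_ B (x ⇒′ y) (x ⇒B y)))
  -- (ii), Boolean codomain, f not necessarily surjective
  × ((𝒜 : StrongAlgebra c₁ ℓ₁) (B : BoundedDistributiveLattice c₂ ℓ₂)
     → IsWeaklyBoolean (StrongAlgebra.bdl 𝒜) (StrongAlgebra._⇒_ 𝒜)
     → IsBooleanLattice B
     → (f : StrongAlgebra.Carrier 𝒜 → BoundedDistributiveLattice.Carrier B)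
     → IsBoundedLatticeHom (StrongAlgebra.bdl 𝒜) B f
     → Σ (Op₂ (BoundedDistributiveLattice.Carrier B)) λ _⇒B_ →
         (IsImplication B _⇒B_
          × IsWeaklyBoolean B _⇒B_
          × (∀ a b → BoundedDistributiveLattice._≈_ B
                       (f (StrongAlgebra._⇒_ 𝒜 a b)) (f a ⇒B f b)))
         × (∀ (_⇒′_ : Op₂ (BoundedDistributiveLattice.Carrier B))
            → IsImplication B _⇒′_
            → IsWeaklyBoolean B _⇒′_
            → (∀ a b → BoundedDistributiveLattice._≈_ B
                         (f (StrongAlgebra._⇒_ 𝒜 a b)) (f a ⇒′ f b))
            → ∀ x y → BoundedDistributiveLattice._≈_ B (x ⇒′ y) (x ⇒B y)))
lemma4p1 =
  (λ 𝒜 _ _ isHom _ g-isMonotone gf≈id →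
     let open RetractImplication 𝒜 isHom g-isMonotone gf≈id
     in _⇒_ , isImplication , preserves⇒) ,
  (λ 𝒜 _ isWeaklyBoolean _ isHom surjective →
     let open WeaklyBooleanTransport 𝒜 isWeaklyBoolean isHom
     in uniqueWeaklyBooleanImplication (surjective⇒hasRelativeComplements surjective)) ,
  (λ 𝒜 B isWeaklyBoolean isBoolean _ isHom →
     let open WeaklyBooleanTransport 𝒜 isWeaklyBoolean isHom
     in uniqueWeaklyBooleanImplication
          (LatticeOrder.isBooleanLattice⇒hasRelativeComplements B isBoolean κ))
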